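{- Let $S$ be a numerical semigroup and $\{a_1,\dots,a_n\}\subseteq S$. Then for all non-negative integers $k_1,\dots,k_n$ with $K=\sum_{i=1}^n k_i \geq 2$, $$\sum_{i=1}^n k_i a_i-(K-1)\,m(S) \in \operatorname{MED}(S).$$
   Context: A numerical semigroup is an additive submonoid $S \subseteq \mathbb{Z}_{\geq 0}$ with $\mathbb{Z}_{\geq 0}\setminus S$ finite. $m(S)$ is the smallest nonzero element of $S$; $e(S)$ is the size of the minimal generating set. $S$ is MED (maximal embedding dimension) if $e(S)=m(S)$. $\operatorname{MED}(S)$ denotes the smallest (for inclusion) MED numerical semigroup $T\supseteq S$ with $m(T)=m(S)$ (it exists, and is the intersection of all such $T$). -}

module Defs where

open import Data.Nat using (ℕ; zero; suc; _+_; _≤_; _≥_)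
open import Relation.Binary.PropositionalEquality using (_≡_; _≢_)
open import Data.List using (List; length)
open import Data.List.Membership.Propositional using (_∈_)
open import Data.List.Relation.Unary.Unique.Propositional using (Unique)
open import Data.Product using (Σ; ∃; _×_; _,_)
open import Function.Bundles using (_⇔_)

Subset : Set₁
Subset = ℕ → Set

_⊆ₛ_ : Subset → Subset → Set
S ⊆ₛ T = ∀ x → S x → T x

-- Numerical semigroup: additive submonoid of ℕ with finite complement
-- (finite complement expressed as: there is F with every n ≥ F in S).
record IsNumericalSemigroup (S : Subset) : Set where
  field
    zero∈ : S 0
    +-closed : ∀ x y → S x → S y → S (x + y)
    cofinite : ∃ λ F → ∀ n → F ≤ n → S n

record IsMultiplicity (S : Subset) (m : ℕ) : Set where
  field
    m∈ : S m
    m≢0 : m ≢ 0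
    m-least : ∀ x → S x → x ≢ 0 → m ≤ x

data ⟨_⟩ (A : List ℕ) : ℕ → Set where
  ⟨⟩-zero : ⟨ A ⟩ 0
  ⟨⟩-step : ∀ {a x} → a ∈ A → ⟨ A ⟩ x → ⟨ A ⟩ (a + x)

Generates : List ℕ → Subset → Set
Generates A S = ∀ x → S x ⇔ ⟨ A ⟩ x

_⊆ₗ_ : List ℕ → List ℕ → Set
A ⊆ₗ B = ∀ {x} → x ∈ A → x ∈ B

IsMinimalGeneratingSet : Subset → List ℕ → Set
IsMinimalGeneratingSet S A =
  Generates A S × (∀ B → B ⊆ₗ A → Generates B S → A ⊆ₗ B)

HasEmbeddingDimension : Subset → ℕ → Set
HasEmbeddingDimension S n =
  ∃ λ A → Unique A × IsMinimalGeneratingSet S A × length A ≡ n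

IsMED : Subset → Set
IsMED S = ∃ λ m → IsMultiplicity S m × HasEmbeddingDimension S m

-- x ∈ MED(S): MED(S) is the smallest MED numerical semigroup T ⊇ S with
-- m(T) = m(S), i.e. the intersection of all such T.
InMEDClosure : Subset → ℕ → Set₁
InMEDClosure S x =
  ∀ (T : Subset) → IsNumericalSemigroup T → IsMED T → S ⊆ₛ T →
  (∀ m → IsMultiplicity S m → IsMultiplicity T m) → T x

{-# OPTIONS --safe #-}
module Submission where

open import Defs
open import Data.Nat using (ℕ; _+_; _*_; _∸_; _≤_)
open import Data.Fin using (Fin)
open import Data.Vec using (sum; tabulate)
open import Relation.Binary.PropositionalEquality using (_≢_)

open import Data.Nat using (zero; suc; s≤s; _<_; _<?_; _≟_; NonZero; ≢-nonZero)
open import Data.Nat.Properties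
open import Data.Nat.Tactic.RingSolver using (solve-∀)
open import Data.Nat.DivMod using (_%_; _/_; _mod_; m≡m%n+[m/n]*n; /-mono-≤)
import Data.Fin as Fin
open import Data.Fin.Properties using (pigeonhole; fromℕ<-injective)
open import Data.List using (List; length; lookup; filter)
open import Data.List.Membership.Propositional using (_∈_)
open import Data.List.Membership.Propositional.Properties using (∈-lookup; ∈-filter⁺; ∈-filter⁻)
open import Data.List.Relation.Unary.AllPairs using (AllPairs; _∷_)
import Data.List.Relation.Unary.All as All
open import Data.List.Relation.Unary.Unique.Propositional using (Unique)
open import Data.Product using (∃; _×_; _,_; proj₁; proj₂)
open import Function using (_∘_)
open import Function.Bundles using (mk⇔; Equivalence)
open import Relation.Binary.Definitions using (tri<; tri≈; tri>)
open import Relation.Binary.PropositionalEquality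
  using (_≡_; refl; sym; trans; cong; subst; subst₂; module ≡-Reasoning)
open import Relation.Nullary using (¬_; ¬?; yes; no; contradiction)

open Equivalence using (to; from)

-- Let T ⊇ S be MED with multiplicity m, so its minimal generating set A has m elements.
-- Two distinct minimal generators are incongruent mod m (if b = a + j·m with j ≥ 1, then b
-- is a sum of two nonzero elements of T), so A meets every residue class mod m. Given
-- nonzero x, y ∈ T, take a ∈ A with a ≡ x + y: if x + y ≤ a then a = x + (y + j·m) is again
-- reducible, so x + y = a + (j + 1)·m and x + y − m ∈ T. Merging the K = Σ kᵢ summands aᵢ
-- one at a time with this rule yields Σ kᵢ aᵢ − (K − 1)·m ∈ T.

AllPairs-lookup : ∀ {A : Set} {R : A → A → Set} {xs : List A} → AllPairs R xs →
  ∀ {i j : Fin (length xs)} → i Fin.< j → R (lookup xs i) (lookup xs j)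
AllPairs-lookup (px ∷ _)  {Fin.zero}  {Fin.suc j} _         = All.lookup px (∈-lookup j)
AllPairs-lookup (_ ∷ pxs) {Fin.suc i} {Fin.suc j} (s≤s i<j) = AllPairs-lookup pxs i<j

%≡%∧≤⇒≡+* : ∀ {m} .{{_ : NonZero m}} {a b} → a % m ≡ b % m → a ≤ b → ∃ λ j → b ≡ a + j * m
%≡%∧≤⇒≡+* {m} {a} {b} a≡b a≤b = j , b≡a+j*m
  where
  j = b / m ∸ a / m
  open ≡-Reasoning
  b≡a+j*m : b ≡ a + j * m
  b≡a+j*m = begin
    b                             ≡⟨ m≡m%n+[m/n]*n b m ⟩
    b % m + (b / m) * m           ≡⟨ cong (λ t → b % m + t * m) (sym (m+[n∸m]≡n (/-mono-≤ a≤b ≤-refl))) ⟩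
    b % m + (a / m + j) * m       ≡⟨ cong (λ t → t + (a / m + j) * m) (sym a≡b) ⟩
    a % m + (a / m + j) * m       ≡⟨ cong (a % m +_) (*-distribʳ-+ m (a / m) j) ⟩
    a % m + ((a / m) * m + j * m) ≡⟨ +-assoc (a % m) _ _ ⟨
    (a % m + (a / m) * m) + j * m ≡⟨ cong (_+ j * m) (sym (m≡m%n+[m/n]*n a m)) ⟩
    a + j * m                     ∎

%≡%∧<⇒≡+suc* : ∀ {m} .{{_ : NonZero m}} {a b} → a % m ≡ b % m → a < b → ∃ λ j → b ≡ a + suc j * m
%≡%∧<⇒≡+suc* {a = a} a≡b a<b with %≡%∧≤⇒≡+* a≡b (<⇒≤ a<b)
... | zero  , b≡a+0 = contradiction (trans b≡a+0 (+-identityʳ a)) (>⇒≢ a<b)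
... | suc j , b≡a+[1+j]m = j , b≡a+[1+j]m

residues-complete : ∀ {m} .{{_ : NonZero m}} (A : List ℕ) → Unique A → length A ≡ m →
  (∀ {a b} → a ∈ A → b ∈ A → a ≢ b → a % m ≢ b % m) →
  ∀ z → ∃ λ a → a ∈ A × z % m ≡ a % m
residues-complete {m} A unique |A|≡m incongruent z
  with pigeonhole (≤-reflexive (cong suc (sym |A|≡m))) residue
  where
  residue : Fin (suc (length A)) → Fin m
  residue Fin.zero    = z mod m
  residue (Fin.suc i) = lookup A i mod m
... | Fin.zero  , Fin.suc j , _ , same =
  lookup A j , ∈-lookup j , fromℕ<-injective _ _ _ _ same
... | Fin.suc i , Fin.suc j , s≤s i<j , same =
  contradiction (fromℕ<-injective _ _ _ _ same)
                (incongruent (∈-lookup i) (∈-lookup j) (AllPairs-lookup unique i<j))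

⟨⟩-+ : ∀ {A x y} → ⟨ A ⟩ x → ⟨ A ⟩ y → ⟨ A ⟩ (x + y)
⟨⟩-+ ⟨⟩-zero q = q
⟨⟩-+ {y = y} (⟨⟩-step {a} {x} a∈A p) q = subst ⟨ _ ⟩ (sym (+-assoc a x y)) (⟨⟩-step a∈A (⟨⟩-+ p q))

⟨⟩-mono : ∀ {A B} → A ⊆ₗ B → ∀ {x} → ⟨ A ⟩ x → ⟨ B ⟩ x
⟨⟩-mono A⊆B ⟨⟩-zero         = ⟨⟩-zero
⟨⟩-mono A⊆B (⟨⟩-step a∈A p) = ⟨⟩-step (A⊆B a∈A) (⟨⟩-mono A⊆B p)

_without_ : List ℕ → ℕ → List ℕ
A without b = filter (λ c → ¬? (c ≟ b)) A

without-⊆ : ∀ {A} b → (A without b) ⊆ₗ A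
without-⊆ {A} b = proj₁ ∘ ∈-filter⁻ (λ c → ¬? (c ≟ b)) {xs = A}

∉-without : ∀ {A} b → ¬ b ∈ A without b
∉-without {A} b b∈ = proj₂ (∈-filter⁻ (λ c → ¬? (c ≟ b)) {xs = A} b∈) refl

∈-without⁺ : ∀ {A a b} → a ∈ A → a ≢ b → a ∈ A without b
∈-without⁺ = ∈-filter⁺ (λ c → ¬? (c ≟ _))

⟨⟩-without-< : ∀ {A b x} → ⟨ A ⟩ x → x < b → ⟨ A without b ⟩ x
⟨⟩-without-< ⟨⟩-zero _ = ⟨⟩-zero
⟨⟩-without-< (⟨⟩-step {a} {x} a∈A p) a+x<b =
  ⟨⟩-step (∈-without⁺ a∈A (<⇒≢ (≤-<-trans (m≤m+n a x) a+x<b)))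
          (⟨⟩-without-< p (≤-<-trans (m≤n+m x a) a+x<b))

⟨⟩-without-redundant : ∀ {A b} → ⟨ A without b ⟩ b → ∀ {x} → ⟨ A ⟩ x → ⟨ A without b ⟩ x
⟨⟩-without-redundant b∈⟨A∖b⟩ ⟨⟩-zero = ⟨⟩-zero
⟨⟩-without-redundant {b = b} b∈⟨A∖b⟩ (⟨⟩-step {a} a∈A p) with a ≟ b
... | yes refl = ⟨⟩-+ b∈⟨A∖b⟩ (⟨⟩-without-redundant b∈⟨A∖b⟩ p)
... | no a≢b   = ⟨⟩-step (∈-without⁺ a∈A a≢b) (⟨⟩-without-redundant b∈⟨A∖b⟩ p)

module MinimalGeneratingSet {T : Subset} {A : List ℕ} (minimal : IsMinimalGeneratingSet T A) where

  generates : Generates A T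
  generates = proj₁ minimal

  generator∈ : ∀ {a} → a ∈ A → T a
  generator∈ {a} a∈A = from (generates a) (subst ⟨ A ⟩ (+-identityʳ a) (⟨⟩-step a∈A ⟨⟩-zero))

  generator-not-redundant : ∀ {b} → b ∈ A → ¬ ⟨ A without b ⟩ b
  generator-not-redundant {b} b∈A b∈⟨A∖b⟩ =
    ∉-without {A} b (proj₂ minimal (A without b) (without-⊆ b) generates′ b∈A)
    where
    generates′ : Generates (A without b) T
    generates′ x = mk⇔ (⟨⟩-without-redundant b∈⟨A∖b⟩ ∘ to (generates x))
                       (from (generates x) ∘ ⟨⟩-mono (without-⊆ b))

  generator≢0 : ∀ {b} → b ∈ A → b ≢ 0
  generator≢0 b∈A refl = generator-not-redundant b∈A ⟨⟩-zero

  generator-irreducible : ∀ {b x y} → b ∈ A → T x → T y → x ≢ 0 → y ≢ 0 → b ≢ x + y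
  generator-irreducible {x = x} {y} b∈A x∈T y∈T x≢0 y≢0 refl = generator-not-redundant b∈A
    (⟨⟩-+ (⟨⟩-without-< (to (generates x) x∈T) (m<m+n x (n≢0⇒n>0 y≢0)))
          (⟨⟩-without-< (to (generates y) y∈T) (m<n+m y (n≢0⇒n>0 x≢0))))

MEDClosed : Subset → ℕ → Set
MEDClosed T m = ∀ {x y} → T x → T y → x ≢ 0 → y ≢ 0 → T (x + y ∸ m)

*-closed : ∀ {T} → IsNumericalSemigroup T → ∀ {x} j → T x → T (j * x)
*-closed NS zero    x∈T = IsNumericalSemigroup.zero∈ NS
*-closed NS (suc j) x∈T = IsNumericalSemigroup.+-closed NS _ _ x∈T (*-closed NS j x∈T)

module MEDFromMinimalGeneratingSet {T A} (NS : IsNumericalSemigroup T)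
  (minimal : IsMinimalGeneratingSet T A) {m} (m∈T : T m) (m≢0 : m ≢ 0) where

  open IsNumericalSemigroup NS
  open MinimalGeneratingSet minimal

  private instance
    m-nonZero : NonZero m
    m-nonZero = ≢-nonZero m≢0

  generators-incongruent-< : ∀ {a b} → a ∈ A → b ∈ A → a < b → a % m ≢ b % m
  generators-incongruent-< a∈A b∈A a<b a≡b with %≡%∧<⇒≡+suc* a≡b a<b
  ... | j , b≡a+[1+j]m = generator-irreducible b∈A (generator∈ a∈A) (*-closed NS (suc j) m∈T)
                           (generator≢0 a∈A) (m≢0 ∘ m+n≡0⇒m≡0 m) b≡a+[1+j]m

  generators-incongruent : ∀ {a b} → a ∈ A → b ∈ A → a ≢ b → a % m ≢ b % m
  generators-incongruent {a} {b} a∈A b∈A a≢b with <-cmp a b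
  ... | tri< a<b _ _ = generators-incongruent-< a∈A b∈A a<b
  ... | tri≈ _ a≡b _ = contradiction a≡b a≢b
  ... | tri> _ _ b<a = generators-incongruent-< b∈A a∈A b<a ∘ sym

  x+y∸m∈-if-congruent-to-generator : ∀ {a x y} → a ∈ A → T x → T y → x ≢ 0 → y ≢ 0 →
    (x + y) % m ≡ a % m → T (x + y ∸ m)
  x+y∸m∈-if-congruent-to-generator {a} {x} {y} a∈A x∈T y∈T x≢0 y≢0 x+y≡a with a <? x + y
  ... | yes a<x+y with %≡%∧<⇒≡+suc* (sym x+y≡a) a<x+y
  ...   | j , x+y≡a+[1+j]m =
    subst T (sym x+y∸m≡a+jm) (+-closed _ _ (generator∈ a∈A) (*-closed NS j m∈T))
    where
    x+y∸m≡a+jm : x + y ∸ m ≡ a + j * m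
    x+y∸m≡a+jm = trans (cong (_∸ m) x+y≡a+[1+j]m)
                       (trans (+-∸-assoc a (m≤m+n m (j * m))) (cong (a +_) (m+n∸m≡n m (j * m))))
  x+y∸m∈-if-congruent-to-generator {a} {x} {y} a∈A x∈T y∈T x≢0 y≢0 x+y≡a | no a≮x+y
    with %≡%∧≤⇒≡+* x+y≡a (≮⇒≥ a≮x+y)
  ... | j , a≡x+y+jm = contradiction (trans a≡x+y+jm (+-assoc x y (j * m)))
          (generator-irreducible a∈A x∈T (+-closed _ _ y∈T (*-closed NS j m∈T))
                                 x≢0 (y≢0 ∘ m+n≡0⇒m≡0 y))

  length≡m⇒MEDClosed : Unique A → length A ≡ m → MEDClosed T m
  length≡m⇒MEDClosed unique |A|≡m {x} {y} x∈T y∈T x≢0 y≢0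
    with residues-complete A unique |A|≡m generators-incongruent (x + y)
  ... | a , a∈A , x+y≡a = x+y∸m∈-if-congruent-to-generator a∈A x∈T y∈T x≢0 y≢0 x+y≡a

module ShiftedSums {T : Subset} {m : ℕ} (mult : IsMultiplicity T m) (med : MEDClosed T m) where

  open IsMultiplicity mult

  -- The invariant of the merging: a sum of K nonzero elements of T is (K − 1)·m plus a
  -- nonzero element of T.
  data Shifted : ℕ → ℕ → Set where
    empty   : Shifted 0 0
    shifted : ∀ p {u} → T u → u ≢ 0 → Shifted (p * m + u) (suc p)

  Shifted-+ : ∀ {V₁ K₁ V₂ K₂} → Shifted V₁ K₁ → Shifted V₂ K₂ → Shifted (V₁ + V₂) (K₁ + K₂)
  Shifted-+ empty s = s
  Shifted-+ {V₁} {K₁} s empty = subst₂ Shifted (sym (+-identityʳ V₁)) (sym (+-identityʳ K₁)) s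
  Shifted-+ (shifted p₁ u₁∈T u₁≢0) (shifted p₂ {u₂} u₂∈T u₂≢0)
    with m≤n⇒∃[o]m+o≡n (m-least _ u₁∈T u₁≢0)
  ... | w , refl = subst₂ Shifted (sym (rearrange p₁ p₂ m w u₂)) (cong suc (sym (+-suc p₁ p₂)))
                     (shifted (suc (p₁ + p₂)) w+u₂∈T w+u₂≢0)
    where
    rearrange : ∀ p q n w u → (p * n + (n + w)) + (q * n + u) ≡ suc (p + q) * n + (w + u)
    rearrange = solve-∀
    w+u₂∈T : T (w + u₂)
    w+u₂∈T = subst T (trans (cong (_∸ m) (+-assoc m w u₂)) (m+n∸m≡n m (w + u₂)))
                     (med u₁∈T u₂∈T u₁≢0 u₂≢0)
    w+u₂≢0 : w + u₂ ≢ 0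
    w+u₂≢0 = u₂≢0 ∘ m+n≡0⇒n≡0 w

  Shifted-* : ∀ {a} → T a → a ≢ 0 → ∀ k → Shifted (k * a) k
  Shifted-* a∈T a≢0 zero    = empty
  Shifted-* a∈T a≢0 (suc k) = Shifted-+ (shifted 0 a∈T a≢0) (Shifted-* a∈T a≢0 k)

  Shifted-sum : ∀ n (a k : Fin n → ℕ) → (∀ i → T (a i)) → (∀ i → a i ≢ 0) →
    Shifted (sum (tabulate (λ i → k i * a i))) (sum (tabulate k))
  Shifted-sum zero    a k a∈T a≢0 = empty
  Shifted-sum (suc n) a k a∈T a≢0 = Shifted-+ (Shifted-* (a∈T Fin.zero) (a≢0 Fin.zero) (k Fin.zero))
    (Shifted-sum n (a ∘ Fin.suc) (k ∘ Fin.suc) (a∈T ∘ Fin.suc) (a≢0 ∘ Fin.suc))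

  Shifted⇒∈ : ∀ {V K} → Shifted V K → 1 ≤ K → T (V ∸ (K ∸ 1) * m)
  Shifted⇒∈ empty ()
  Shifted⇒∈ (shifted p {u} u∈T _) _ = subst T (sym (m+n∸m≡n (p * m) u)) u∈T

multiplicity-unique : ∀ {T m m′} → IsMultiplicity T m → IsMultiplicity T m′ → m ≡ m′
multiplicity-unique m-mult m′-mult = ≤-antisym (m-least m-mult _ (m∈ m′-mult) (m≢0 m′-mult))
                                               (m-least m′-mult _ (m∈ m-mult) (m≢0 m-mult))
  where open IsMultiplicity

mainTheorem5 : (S : Subset) → IsNumericalSemigroup S →
    (m : ℕ) → IsMultiplicity S m →
    (n : ℕ) (a : Fin n → ℕ) → (∀ i → S (a i)) → (∀ i → a i ≢ 0) →
    (k : Fin n → ℕ) → 2 ≤ sum (tabulate k) →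
    InMEDClosure S (sum (tabulate (λ i → k i * a i)) ∸ (sum (tabulate k) ∸ 1) * m)
mainTheorem5 S _ m m-mult n a a∈S a≢0 k 2≤K
             T T-ns (m′ , m′-mult , A , A-unique , A-minimal , |A|≡m′) S⊆T mult-preserved =
  Shifted⇒∈ (Shifted-sum n a k (λ i → S⊆T _ (a∈S i)) a≢0) (<⇒≤ 2≤K)
  where
  T-mult : IsMultiplicity T m
  T-mult = mult-preserved m m-mult
  open IsMultiplicity T-mult using (m∈; m≢0)
  |A|≡m : length A ≡ m
  |A|≡m = trans |A|≡m′ (sym (multiplicity-unique T-mult m′-mult))
  open MEDFromMinimalGeneratingSet T-ns A-minimal m∈ m≢0 using (length≡m⇒MEDClosed)
  open ShiftedSums T-mult (length≡m⇒MEDClosed A-unique |A|≡m)
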